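{- The graph $5C_4^=$ is strongly $\mathbb{Z}_7$-connected. Further, if $G$ is a graph with $|V(G)|=4$, $|E(G)|=19$, $\mu(G)\le 5$, and minimum degree $\delta(G)\ge 8$, then $G$ is strongly $\mathbb{Z}_7$-connected.
   Context: Graphs may have multiple edges but no loops. $\mu(G)$ is the maximum number of parallel edges joining a pair of vertices of $G$. $5C_4^=$ is the graph obtained from the $4$-cycle with every edge replaced by $5$ parallel edges by deleting one copy of each edge of a perfect matching; i.e. vertices $v_1,v_2,v_3,v_4$ with $v_1v_2$ and $v_3v_4$ of multiplicity $4$, $v_2v_3$ and $v_4v_1$ of multiplicity $5$, and no other edges. A $\mathbb{Z}_7$-boundary is $\beta:V(G)\to\mathbb{Z}_7$ with $\sum_v\beta(v)\equiv0\pmod 7$; a $(\mathbb{Z}_7,\beta)$-orientation is an orientation $D$ with $d^+_D(v)-d^-_D(v)\equiv\beta(v)\pmod 7$ for all $v$; $G$ is strongly $\mathbb{Z}_7$-connected if it has a $(\mathbb{Z}_7,\beta)$-orientation for every $\mathbb{Z}_7$-boundary $\beta$. -}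

module Defs where

open import Data.Nat using (ℕ; zero; suc; _+_; _≤_)
open import Data.Fin using (Fin; zero; suc; toℕ; _≟_)
open import Data.Integer as ℤ using (ℤ; +_; _-_)
open import Data.Integer.Divisibility using (_∣_)
open import Data.List using (List; []; _∷_; length; replicate; _++_; map; allFin)
open import Data.Nat.ListAction using (sum)
open import Data.List.Relation.Unary.All using (All)
open import Data.Product using (Σ; _×_; _,_; proj₁; proj₂)
open import Data.Bool using (Bool; true; false)
open import Relation.Binary.PropositionalEquality using (_≡_; _≢_)
open import Relation.Nullary using (¬_; yes; no)

-- A multigraph on vertex set Fin n, given by its list of edges; an edge
-- (a , b) joins a and b (orientation of the pair is irrelevant).
-- Multiple edges are allowed (repeated entries).
Multigraph : ℕ → Set
Multigraph n = List (Fin n × Fin n)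

Loopless : ∀ {n} → Multigraph n → Set
Loopless G = All (λ e → proj₁ e ≢ proj₂ e) G

incid : ∀ {n} → Fin n → Fin n × Fin n → ℕ
incid v (a , b) with v ≟ a | v ≟ b
... | yes _ | _ = 1
... | no _ | yes _ = 1
... | no _ | no _ = 0

-- degree of v (number of incident edges; G is loopless)
deg : ∀ {n} → Multigraph n → Fin n → ℕ
deg [] v = 0
deg (e ∷ G) v = incid v e + deg G v

joins : ∀ {n} → Fin n → Fin n → Fin n × Fin n → ℕ
joins u v (a , b) with u ≟ a | v ≟ b | u ≟ b | v ≟ a
... | yes _ | yes _ | _ | _ = 1
... | _ | _ | yes _ | yes _ = 1
... | _ | _ | _ | _ = 0

mult : ∀ {n} → Multigraph n → Fin n → Fin n → ℕ
mult [] u v = 0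
mult (e ∷ G) u v = joins u v e + mult G u v

MaxMultAtMost : ∀ {n} → Multigraph n → ℕ → Set
MaxMultAtMost G k = ∀ u v → u ≢ v → mult G u v ≤ k

MinDegAtLeast : ∀ {n} → Multigraph n → ℕ → Set
MinDegAtLeast G k = ∀ v → k ≤ deg G v

-- An orientation assigns a Bool to each edge (by position in the list):
-- true  : edge (a , b) is oriented a → b,
-- false : edge (a , b) is oriented b → a.
Orientation : ∀ {n} → Multigraph n → Set
Orientation G = Fin (length G) → Bool

-- contribution of an oriented arc tail → head to d⁺(v) - d⁻(v)
arcNet : ∀ {n} → Fin n → Fin n → Fin n → ℤ
arcNet v t h with v ≟ t | v ≟ h
... | yes _ | no _ = + 1
... | no _ | yes _ = ℤ.- (+ 1)
... | _ | _ = + 0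

netOut : ∀ {n} (G : Multigraph n) → Orientation G → Fin n → ℤ
netOut [] D v = + 0
netOut ((a , b) ∷ G) D v with D zero
... | true  = arcNet v a b ℤ.+ netOut G (λ i → D (suc i)) v
... | false = arcNet v b a ℤ.+ netOut G (λ i → D (suc i)) v

sumZ7 : ∀ {n} → (Fin n → Fin 7) → ℕ
sumZ7 β = sum (map (λ v → toℕ (β v)) (allFin _))

IsBoundary : ∀ {n} → (Fin n → Fin 7) → Set
IsBoundary β = + 7 ∣ (+ sumZ7 β)

IsZ7Orientation : ∀ {n} (G : Multigraph n) → (Fin n → Fin 7) → Orientation G → Set
IsZ7Orientation G β D = ∀ v → + 7 ∣ (netOut G D v - + toℕ (β v))

StronglyZ7Connected : ∀ {n} → Multigraph n → Set
StronglyZ7Connected {n} G =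
  (β : Fin n → Fin 7) → IsBoundary β → Σ (Orientation G) (IsZ7Orientation G β)

v1 v2 v3 v4 : Fin 4
v1 = zero
v2 = suc zero
v3 = suc (suc zero)
v4 = suc (suc (suc zero))

fiveC4= : Multigraph 4
fiveC4= = replicate 4 (v1 , v2) ++ replicate 5 (v2 , v3)
       ++ replicate 4 (v3 , v4) ++ replicate 5 (v4 , v1)

-- Only the multiplicity profile m of a multigraph on four vertices matters: orienting f p of the
-- m p parallel edges of each pair p from its lower to its higher end (every split f ≤ m is realised
-- greedily, edge by edge) gives the net out-degrees ∂ (2f − m), the divergence of a flow on K₄.
-- So strong Z₇-connectivity asks, for every boundary β, for a split whose flow has divergence
-- ≡ β (mod 7) at three vertices; the fourth follows because divergences and boundaries both sum
-- to 0. For 5C₄⁼ and for each of the finitely many profiles with multiplicities at most 5, 19 edges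
-- and all degrees at least 8, such splits are found by search and verified by evaluation.

module Submission where

open import Defs
open import Data.Bool using (Bool; true; false; T; _∧_; if_then_else_)
open import Data.Bool.ListAction using (all)
open import Data.Bool.Properties using (T-∧; T-≡)
open import Data.Fin as Fin using (Fin; zero; suc; toℕ)
open import Data.Fin.Properties using (all?; toℕ-fromℕ<)
open import Data.Integer as ℤ using (ℤ; +_; -_)
open import Data.Integer.Divisibility using (_∣_)
import Data.Integer.Divisibility.Signed as Signed
import Data.Integer.Properties as ℤ using (+-identityʳ)
open import Data.Integer.Tactic.RingSolver using (solve-∀)
open import Data.List using ([]; _∷_; length; allFin)
open import Data.List.Membership.Propositional.Properties using (∈-allFin)
import Data.List.Relation.Unary.All as All
open import Data.List.Relation.Unary.All using ([]; _∷_)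
open import Data.List.Relation.Unary.All.Properties using (all⁺)
open import Data.Maybe using (Maybe; just; nothing; maybe; _<∣>_; _>>=_)
open import Data.Nat as ℕ using (ℕ; zero; suc; _+_; _*_; _∸_; _%_; _≤_; _<_; _≤ᵇ_; z≤n; s≤s)
import Data.Nat.Divisibility as ℕ
open import Data.Nat.Properties using (n≤0⇒n≡0; m≤n+o⇒m∸n≤o; m+[n∸m]≡n; ≤ᵇ⇒≤)
import Data.Nat.Tactic.RingSolver as ℕ-Ring
open import Data.Product using (Σ-syntax; ∃; _×_; _,_)
open import Data.Vec using (Vec; []; _∷_; lookup; tabulate)
open import Data.Vec.Properties using (lookup∘tabulate)
open import Function using (_∘_)
open import Function.Bundles using (Equivalence)
open import Relation.Binary.PropositionalEquality
open import Relation.Nullary.Decidable using (Dec; isYes; yes; no; from-yes; toWitness; ¬?; _→-dec_; _×-dec_)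
open import Relation.Nullary.Negation using (contradiction)

Pair : Set
Pair = Fin 6

pattern ₁₂ = zero
pattern ₁₃ = suc zero
pattern ₁₄ = suc (suc zero)
pattern ₂₃ = suc (suc (suc zero))
pattern ₂₄ = suc (suc (suc (suc zero)))
pattern ₃₄ = suc (suc (suc (suc (suc zero))))

low high : Pair → Fin 4
low ₁₂ = v1
low ₁₃ = v1
low ₁₄ = v1
low ₂₃ = v2
low ₂₄ = v2
low ₃₄ = v3
high ₁₂ = v2
high ₁₃ = v3
high ₁₄ = v4
high ₂₃ = v3
high ₂₄ = v4
high ₃₄ = v4

low≢high : ∀ p → low p ≢ high p
low≢high = from-yes (all? λ p → ¬? (low p Fin.≟ high p))

Table : Set → Set
Table A = Pair → A

_≤ᵗ_ : Table ℕ → Table ℕ → Set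
f ≤ᵗ m = ∀ p → f p ≤ m p

unit : Pair → Table ℕ
unit p q with p Fin.≟ q
... | yes _ = 1
... | no _  = 0

total : Table ℕ → ℕ
total m = m ₁₂ + m ₁₃ + m ₁₄ + m ₂₃ + m ₂₄ + m ₃₄

incident : Table ℕ → Fin 4 → ℕ
incident m zero                   = m ₁₂ + m ₁₃ + m ₁₄
incident m (suc zero)             = m ₁₂ + m ₂₃ + m ₂₄
incident m (suc (suc zero))       = m ₁₃ + m ₂₃ + m ₃₄
incident m (suc (suc (suc zero))) = m ₁₄ + m ₂₄ + m ₃₄

profile : Multigraph 4 → Table ℕ
profile G p = mult G (low p) (high p)

edgeProfile : Fin 4 × Fin 4 → Table ℕ
edgeProfile e p = joins (low p) (high p) e

incid≡incident : ∀ v x y → x ≢ y → incid v (x , y) ≡ incident (edgeProfile (x , y)) v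
incid≡incident = from-yes (all? λ v → all? λ x → all? λ y →
  ¬? (x Fin.≟ y) →-dec (incid v (x , y) ℕ.≟ incident (edgeProfile (x , y)) v))

total-edgeProfile : ∀ x y → x ≢ y → total (edgeProfile (x , y)) ≡ 1
total-edgeProfile = from-yes (all? λ x → all? λ y →
  ¬? (x Fin.≟ y) →-dec (total (edgeProfile (x , y)) ℕ.≟ 1))

+-interchange₃ : ∀ x y z x′ y′ z′ → (x + x′) + (y + y′) + (z + z′) ≡ (x + y + z) + (x′ + y′ + z′)
+-interchange₃ = ℕ-Ring.solve-∀

incident-+ : ∀ a b v → incident (λ p → a p + b p) v ≡ incident a v + incident b v
incident-+ a b zero                   = +-interchange₃ (a ₁₂) (a ₁₃) (a ₁₄) (b ₁₂) (b ₁₃) (b ₁₄)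
incident-+ a b (suc zero)             = +-interchange₃ (a ₁₂) (a ₂₃) (a ₂₄) (b ₁₂) (b ₂₃) (b ₂₄)
incident-+ a b (suc (suc zero))       = +-interchange₃ (a ₁₃) (a ₂₃) (a ₃₄) (b ₁₃) (b ₂₃) (b ₃₄)
incident-+ a b (suc (suc (suc zero))) = +-interchange₃ (a ₁₄) (a ₂₄) (a ₃₄) (b ₁₄) (b ₂₄) (b ₃₄)

total-+ : ∀ a b → total (λ p → a p + b p) ≡ total a + total b
total-+ a b = interchange (a ₁₂) (a ₁₃) (a ₁₄) (a ₂₃) (a ₂₄) (a ₃₄) (b ₁₂) (b ₁₃) (b ₁₄) (b ₂₃) (b ₂₄) (b ₃₄)
  where
  interchange : ∀ x₁ x₂ x₃ x₄ x₅ x₆ y₁ y₂ y₃ y₄ y₅ y₆ →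
    (x₁ + y₁) + (x₂ + y₂) + (x₃ + y₃) + (x₄ + y₄) + (x₅ + y₅) + (x₆ + y₆)
      ≡ (x₁ + x₂ + x₃ + x₄ + x₅ + x₆) + (y₁ + y₂ + y₃ + y₄ + y₅ + y₆)
  interchange = ℕ-Ring.solve-∀

deg≡incident : ∀ G → Loopless G → ∀ v → deg G v ≡ incident (profile G) v
deg≡incident []            []             zero                   = refl
deg≡incident []            []             (suc zero)             = refl
deg≡incident []            []             (suc (suc zero))       = refl
deg≡incident []            []             (suc (suc (suc zero))) = refl
deg≡incident ((x , y) ∷ G) (x≢y ∷ loopless) v = begin
  incid v (x , y) + deg G v                                 ≡⟨ cong₂ _+_ (incid≡incident v x y x≢y) (deg≡incident G loopless v) ⟩
  incident (edgeProfile (x , y)) v + incident (profile G) v ≡⟨ incident-+ (edgeProfile (x , y)) (profile G) v ⟨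
  incident (profile ((x , y) ∷ G)) v                        ∎
  where open ≡-Reasoning

length≡total : ∀ G → Loopless G → length G ≡ total (profile G)
length≡total []            []             = refl
length≡total ((x , y) ∷ G) (x≢y ∷ loopless) = begin
  1 + length G                                    ≡⟨ cong₂ _+_ (sym (total-edgeProfile x y x≢y)) (length≡total G loopless) ⟩
  total (edgeProfile (x , y)) + total (profile G) ≡⟨ total-+ (edgeProfile (x , y)) (profile G) ⟨
  total (profile ((x , y) ∷ G))                   ∎
  where open ≡-Reasoning

-- Flows on K₄

∂ : Table ℤ → Fin 4 → ℤ
∂ t zero                   = t ₁₂ ℤ.+ t ₁₃ ℤ.+ t ₁₄
∂ t (suc zero)             = - t ₁₂ ℤ.+ t ₂₃ ℤ.+ t ₂₄
∂ t (suc (suc zero))       = - t ₁₃ ℤ.+ - t ₂₃ ℤ.+ t ₃₄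
∂ t (suc (suc (suc zero))) = - t ₁₄ ℤ.+ - t ₂₄ ℤ.+ - t ₃₄

∂-cong : ∀ {s t} → s ≗ t → ∀ v → ∂ s v ≡ ∂ t v
∂-cong s≗t zero                   rewrite s≗t ₁₂ | s≗t ₁₃ | s≗t ₁₄ = refl
∂-cong s≗t (suc zero)             rewrite s≗t ₁₂ | s≗t ₂₃ | s≗t ₂₄ = refl
∂-cong s≗t (suc (suc zero))       rewrite s≗t ₁₃ | s≗t ₂₃ | s≗t ₃₄ = refl
∂-cong s≗t (suc (suc (suc zero))) rewrite s≗t ₁₄ | s≗t ₂₄ | s≗t ₃₄ = refl

∂-+ : ∀ s t v → ∂ (λ p → s p ℤ.+ t p) v ≡ ∂ s v ℤ.+ ∂ t v
∂-+ s t zero                   = regroup (s ₁₂) (s ₁₃) (s ₁₄) (t ₁₂) (t ₁₃) (t ₁₄)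
  where regroup : ∀ x y z x′ y′ z′ → (x ℤ.+ x′) ℤ.+ (y ℤ.+ y′) ℤ.+ (z ℤ.+ z′) ≡ (x ℤ.+ y ℤ.+ z) ℤ.+ (x′ ℤ.+ y′ ℤ.+ z′)
        regroup = solve-∀
∂-+ s t (suc zero)             = regroup (s ₁₂) (s ₂₃) (s ₂₄) (t ₁₂) (t ₂₃) (t ₂₄)
  where regroup : ∀ x y z x′ y′ z′ → - (x ℤ.+ x′) ℤ.+ (y ℤ.+ y′) ℤ.+ (z ℤ.+ z′) ≡ (- x ℤ.+ y ℤ.+ z) ℤ.+ (- x′ ℤ.+ y′ ℤ.+ z′)
        regroup = solve-∀
∂-+ s t (suc (suc zero))       = regroup (s ₁₃) (s ₂₃) (s ₃₄) (t ₁₃) (t ₂₃) (t ₃₄)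
  where regroup : ∀ x y z x′ y′ z′ → - (x ℤ.+ x′) ℤ.+ - (y ℤ.+ y′) ℤ.+ (z ℤ.+ z′) ≡ (- x ℤ.+ - y ℤ.+ z) ℤ.+ (- x′ ℤ.+ - y′ ℤ.+ z′)
        regroup = solve-∀
∂-+ s t (suc (suc (suc zero))) = regroup (s ₁₄) (s ₂₄) (s ₃₄) (t ₁₄) (t ₂₄) (t ₃₄)
  where regroup : ∀ x y z x′ y′ z′ → - (x ℤ.+ x′) ℤ.+ - (y ℤ.+ y′) ℤ.+ - (z ℤ.+ z′) ≡ (- x ℤ.+ - y ℤ.+ - z) ℤ.+ (- x′ ℤ.+ - y′ ℤ.+ - z′)
        regroup = solve-∀

∂-zero : ∀ v → ∂ (λ _ → + 0) v ≡ + 0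
∂-zero = from-yes (all? λ v → ∂ (λ _ → + 0) v ℤ.≟ + 0)

∂-sum : ∀ t → ∂ t v1 ℤ.+ ∂ t v2 ℤ.+ ∂ t v3 ℤ.+ ∂ t v4 ≡ + 0
∂-sum t = cancel (t ₁₂) (t ₁₃) (t ₁₄) (t ₂₃) (t ₂₄) (t ₃₄)
  where
  cancel : ∀ a b c d e f →
    (a ℤ.+ b ℤ.+ c) ℤ.+ (- a ℤ.+ d ℤ.+ e) ℤ.+ (- b ℤ.+ - d ℤ.+ f) ℤ.+ (- c ℤ.+ - e ℤ.+ - f) ≡ + 0
  cancel = solve-∀

-- f of the m parallel edges of a pair oriented from its lower to its higher end give the flow f − (m − f).
surplus : ℕ → ℕ → ℤ
surplus a m = + a ℤ.- (+ m ℤ.- + a)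

flow : Table ℕ → Table ℕ → Table ℤ
flow f m p = surplus (f p) (m p)

surplus-along : ∀ {a c} b → c ≤ a → surplus a (c + b) ≡ + c ℤ.+ surplus (a ∸ c) b
surplus-along {a} {c} b c≤a with a ∸ c | m+[n∸m]≡n c≤a
... | d | refl = shift (+ c) (+ d) (+ b)
  where shift : ∀ x y z → (x ℤ.+ y) ℤ.- ((x ℤ.+ z) ℤ.- (x ℤ.+ y)) ≡ x ℤ.+ (y ℤ.- (z ℤ.- y))
        shift = solve-∀

surplus-against : ∀ a c b → surplus a (c + b) ≡ - + c ℤ.+ surplus a b
surplus-against a c b = shift (+ a) (+ c) (+ b)
  where shift : ∀ x y z → x ℤ.- ((y ℤ.+ z) ℤ.- x) ≡ - y ℤ.+ (x ℤ.- (z ℤ.- x))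
        shift = solve-∀

-- Realising splits by orientations

Realisable : Multigraph 4 → Table ℤ → Set
Realisable G t = Σ[ D ∈ Orientation G ] ∀ v → netOut G D v ≡ ∂ t v

RealisesSplits : Multigraph 4 → Set
RealisesSplits G = ∀ f → f ≤ᵗ profile G → Realisable G (flow f (profile G))

arcNetᵇ : Bool → Fin 4 → Fin 4 → Fin 4 → ℤ
arcNetᵇ true  x y v = arcNet v x y
arcNetᵇ false x y v = arcNet v y x

extend : ∀ {x y G t t′} b → Realisable G t →
         (∀ v → arcNetᵇ b x y v ℤ.+ ∂ t v ≡ ∂ t′ v) → Realisable ((x , y) ∷ G) t′
extend {x} {y} true  (D , D-net) step =
  (λ { zero → true ; (suc i) → D i }) , λ v → trans (cong (ℤ._+_ (arcNet v x y)) (D-net v)) (step v)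
extend {x} {y} false (D , D-net) step =
  (λ { zero → false ; (suc i) → D i }) , λ v → trans (cong (ℤ._+_ (arcNet v y x)) (D-net v)) (step v)

data EdgeView : Fin 4 → Fin 4 → Set where
  loop    : ∀ x → EdgeView x x
  lowHigh : ∀ p → EdgeView (low p) (high p)
  highLow : ∀ p → EdgeView (high p) (low p)

edgeView : ∀ x y → EdgeView x y
edgeView zero                   zero                   = loop _
edgeView zero                   (suc zero)             = lowHigh ₁₂
edgeView zero                   (suc (suc zero))       = lowHigh ₁₃
edgeView zero                   (suc (suc (suc zero))) = lowHigh ₁₄
edgeView (suc zero)             zero                   = highLow ₁₂
edgeView (suc zero)             (suc zero)             = loop _
edgeView (suc zero)             (suc (suc zero))       = lowHigh ₂₃
edgeView (suc zero)             (suc (suc (suc zero))) = lowHigh ₂₄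
edgeView (suc (suc zero))       zero                   = highLow ₁₃
edgeView (suc (suc zero))       (suc zero)             = highLow ₂₃
edgeView (suc (suc zero))       (suc (suc zero))       = loop _
edgeView (suc (suc zero))       (suc (suc (suc zero))) = lowHigh ₃₄
edgeView (suc (suc (suc zero))) zero                   = highLow ₁₄
edgeView (suc (suc (suc zero))) (suc zero)             = highLow ₂₄
edgeView (suc (suc (suc zero))) (suc (suc zero))       = highLow ₃₄
edgeView (suc (suc (suc zero))) (suc (suc (suc zero))) = loop _

edgeProfile-loop : ∀ x → edgeProfile (x , x) ≗ λ _ → 0
edgeProfile-loop = from-yes (all? λ x → all? λ q → edgeProfile (x , x) q ℕ.≟ 0)

edgeProfile-lowHigh : ∀ p → edgeProfile (low p , high p) ≗ unit p
edgeProfile-lowHigh = from-yes (all? λ p → all? λ q → edgeProfile (low p , high p) q ℕ.≟ unit p q)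

edgeProfile-highLow : ∀ p → edgeProfile (high p , low p) ≗ unit p
edgeProfile-highLow = from-yes (all? λ p → all? λ q → edgeProfile (high p , low p) q ℕ.≟ unit p q)

arcNet-loop : ∀ x v → arcNet v x x ≡ ∂ (λ _ → - + 0) v
arcNet-loop = from-yes (all? λ x → all? λ v → arcNet v x x ℤ.≟ ∂ (λ _ → - + 0) v)

arcNet-lowHigh : ∀ p v → arcNet v (low p) (high p) ≡ ∂ (+_ ∘ unit p) v
arcNet-lowHigh = from-yes (all? λ p → all? λ v → arcNet v (low p) (high p) ℤ.≟ ∂ (+_ ∘ unit p) v)

arcNet-highLow : ∀ p v → arcNet v (high p) (low p) ≡ ∂ (λ q → - + unit p q) v
arcNet-highLow = from-yes (all? λ p → all? λ v → arcNet v (high p) (low p) ℤ.≟ ∂ (λ q → - + unit p q) v)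

unit≤ᵗ : ∀ {f n} p → f p ≡ suc n → unit p ≤ᵗ f
unit≤ᵗ p fp≡suc q with p Fin.≟ q
... | yes refl = subst (1 ≤_) (sym fp≡suc) (s≤s z≤n)
... | no _     = z≤n

≤ᵗ-without-unit : ∀ {f m} p → f p ≡ 0 → f ≤ᵗ (λ q → unit p q + m q) → f ≤ᵗ m
≤ᵗ-without-unit p fp≡0 f≤ q with p Fin.≟ q | f≤ q
... | yes refl | _   = subst (_≤ _) (sym fp≡0) z≤n
... | no _     | f≤q = f≤q

≤ᵗ-profile-cons : ∀ {x y G f u} → edgeProfile (x , y) ≗ u →
                  f ≤ᵗ profile ((x , y) ∷ G) → f ≤ᵗ (λ q → u q + profile G q)
≤ᵗ-profile-cons {G = G} {f} e≗u f≤ q = subst (λ n → f q ≤ n + profile G q) (e≗u q) (f≤ q)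

flow-profile-cons : ∀ {x y G f u} → edgeProfile (x , y) ≗ u →
                    flow f (profile ((x , y) ∷ G)) ≗ flow f (λ q → u q + profile G q)
flow-profile-cons {G = G} {f} e≗u q = cong (λ n → surplus (f q) (n + profile G q)) (e≗u q)

extend-along : ∀ {x y G f} u b → edgeProfile (x , y) ≗ u → (∀ v → arcNetᵇ b x y v ≡ ∂ (+_ ∘ u) v) →
               RealisesSplits G → u ≤ᵗ f → f ≤ᵗ profile ((x , y) ∷ G) →
               Realisable ((x , y) ∷ G) (flow f (profile ((x , y) ∷ G)))
extend-along {x} {y} {G} {f} u b e≗u arc realiseG u≤f f≤ = extend b (realiseG f′ f′≤) λ v → begin
  arcNetᵇ b x y v ℤ.+ ∂ (flow f′ (profile G)) v ≡⟨ cong (ℤ._+ ∂ (flow f′ (profile G)) v) (arc v) ⟩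
  ∂ (+_ ∘ u) v ℤ.+ ∂ (flow f′ (profile G)) v    ≡⟨ ∂-+ _ _ v ⟨
  ∂ (λ q → + u q ℤ.+ flow f′ (profile G) q) v  ≡⟨ ∂-cong (λ q → surplus-along (profile G q) (u≤f q)) v ⟨
  ∂ (flow f (λ q → u q + profile G q)) v       ≡⟨ ∂-cong (flow-profile-cons {G = G} {f} e≗u) v ⟨
  ∂ (flow f (profile ((x , y) ∷ G))) v         ∎
  where
  open ≡-Reasoning
  f′ : Table ℕ
  f′ q = f q ∸ u q
  f′≤ : f′ ≤ᵗ profile G
  f′≤ q = m≤n+o⇒m∸n≤o (f q) (u q) (≤ᵗ-profile-cons {G = G} e≗u f≤ q)

extend-against : ∀ {x y G f} u b → edgeProfile (x , y) ≗ u → (∀ v → arcNetᵇ b x y v ≡ ∂ (λ q → - + u q) v) →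
                 RealisesSplits G → f ≤ᵗ profile G →
                 Realisable ((x , y) ∷ G) (flow f (profile ((x , y) ∷ G)))
extend-against {x} {y} {G} {f} u b e≗u arc realiseG f≤ = extend b (realiseG f f≤) λ v → begin
  arcNetᵇ b x y v ℤ.+ ∂ (flow f (profile G)) v     ≡⟨ cong (ℤ._+ ∂ (flow f (profile G)) v) (arc v) ⟩
  ∂ (λ q → - + u q) v ℤ.+ ∂ (flow f (profile G)) v ≡⟨ ∂-+ _ _ v ⟨
  ∂ (λ q → - + u q ℤ.+ flow f (profile G) q) v    ≡⟨ ∂-cong (λ q → surplus-against (f q) (u q) (profile G q)) v ⟨
  ∂ (flow f (λ q → u q + profile G q)) v          ≡⟨ ∂-cong (flow-profile-cons {G = G} {f} e≗u) v ⟨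
  ∂ (flow f (profile ((x , y) ∷ G))) v            ∎
  where open ≡-Reasoning

-- Greedily, an edge of pair p is oriented from low p to high p while the budget f p lasts.
realise : ∀ G → RealisesSplits G
realise [] f f≤ = (λ ()) , λ v → sym (trans (∂-cong no-flow v) (∂-zero v))
  where
  no-flow : flow f (profile []) ≗ λ _ → + 0
  no-flow q rewrite n≤0⇒n≡0 (f≤ q) = refl
realise ((x , y) ∷ G) f f≤ with edgeView x y
... | loop x = extend-against (λ _ → 0) true (edgeProfile-loop x) (arcNet-loop x) (realise G)
                 (≤ᵗ-profile-cons {G = G} (edgeProfile-loop x) f≤)
... | lowHigh p with f p in fp
...   | zero  = extend-against (unit p) false (edgeProfile-lowHigh p) (arcNet-highLow p) (realise G)
                  (≤ᵗ-without-unit p fp (≤ᵗ-profile-cons {G = G} (edgeProfile-lowHigh p) f≤))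
...   | suc _ = extend-along (unit p) true (edgeProfile-lowHigh p) (arcNet-lowHigh p) (realise G) (unit≤ᵗ p fp) f≤
realise ((x , y) ∷ G) f f≤ | highLow p with f p in fp
...   | zero  = extend-against (unit p) true (edgeProfile-highLow p) (arcNet-highLow p) (realise G)
                  (≤ᵗ-without-unit p fp (≤ᵗ-profile-cons {G = G} (edgeProfile-highLow p) f≤))
...   | suc _ = extend-along (unit p) false (edgeProfile-highLow p) (arcNet-lowHigh p) (realise G) (unit≤ᵗ p fp) f≤

_≡₇_ : ℤ → Fin 7 → Set
z ≡₇ b = + 7 ∣ (z ℤ.- + toℕ b)

_≡₇?_ : ∀ z b → Dec (z ≡₇ b)
z ≡₇? b = 7 ℕ.∣? ℤ.∣ z ℤ.- + toℕ b ∣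

lastVertex : ∀ t β → IsBoundary β →
             ∂ t v1 ≡₇ β v1 → ∂ t v2 ≡₇ β v2 → ∂ t v3 ≡₇ β v3 → ∂ t v4 ≡₇ β v4
lastVertex t β 7∣Σβ c₁ c₂ c₃ = ∣⇒∣ᵤ (subst (+ 7 Signed.∣_) (sym d₄≡-[Σd+Σβ]) (∣m⇒∣-m 7∣Σd+Σβ))
  where
  open Signed using (∣ᵤ⇒∣; ∣⇒∣ᵤ; ∣m∣n⇒∣m+n; ∣m⇒∣-m)
  b : Fin 4 → ℤ
  b v = + toℕ (β v)
  d : Fin 4 → ℤ
  d v = ∂ t v ℤ.- b v
  Σd+Σβ : ℤ
  Σd+Σβ = d v1 ℤ.+ d v2 ℤ.+ d v3 ℤ.+ + sumZ7 β
  7∣Σd+Σβ : + 7 Signed.∣ Σd+Σβ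
  7∣Σd+Σβ = ∣m∣n⇒∣m+n (∣m∣n⇒∣m+n (∣m∣n⇒∣m+n (∣ᵤ⇒∣ {i = d v1} c₁) (∣ᵤ⇒∣ {i = d v2} c₂)) (∣ᵤ⇒∣ {i = d v3} c₃))
                       (∣ᵤ⇒∣ {i = + sumZ7 β} 7∣Σβ)
  rearrange : ∀ a₁ a₂ a₃ a₄ x₁ x₂ x₃ x₄ →
    a₄ ℤ.- x₄ ≡ - ((a₁ ℤ.- x₁) ℤ.+ (a₂ ℤ.- x₂) ℤ.+ (a₃ ℤ.- x₃) ℤ.+ (x₁ ℤ.+ (x₂ ℤ.+ (x₃ ℤ.+ (x₄ ℤ.+ + 0)))))
                ℤ.+ (a₁ ℤ.+ a₂ ℤ.+ a₃ ℤ.+ a₄)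
  rearrange = solve-∀
  d₄≡-[Σd+Σβ] : d v4 ≡ - Σd+Σβ
  d₄≡-[Σd+Σβ] = begin
    d v4                                                      ≡⟨ rearrange (∂ t v1) (∂ t v2) (∂ t v3) (∂ t v4) (b v1) (b v2) (b v3) (b v4) ⟩
    - Σd+Σβ ℤ.+ (∂ t v1 ℤ.+ ∂ t v2 ℤ.+ ∂ t v3 ℤ.+ ∂ t v4) ≡⟨ cong (ℤ._+_ (- Σd+Σβ)) (∂-sum t) ⟩
    - Σd+Σβ ℤ.+ + 0                                           ≡⟨ ℤ.+-identityʳ (- Σd+Σβ) ⟩
    - Σd+Σβ                                                   ∎
    where open ≡-Reasoning

congruent : ∀ t β → IsBoundary β → ∂ t v1 ≡₇ β v1 → ∂ t v2 ≡₇ β v2 → ∂ t v3 ≡₇ β v3 → ∀ v → ∂ t v ≡₇ β v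
congruent t β boundary c₁ c₂ c₃ zero                   = c₁
congruent t β boundary c₁ c₂ c₃ (suc zero)             = c₂
congruent t β boundary c₁ c₂ c₃ (suc (suc zero))       = c₃
congruent t β boundary c₁ c₂ c₃ (suc (suc (suc zero))) = lastVertex t β boundary c₁ c₂ c₃

T-true : ∀ {x} → x ≡ true → T x
T-true refl = _

all-allFin : ∀ {n} (p : Fin n → Bool) → all p (allFin n) ≡ true → ∀ i → p i ≡ true
all-allFin p h i = Equivalence.to T-≡ (All.lookup (all⁺ p (allFin _) (T-true h)) (∈-allFin i))

-- The large checks are phrased with booleans: evaluating stdlib decision procedures such as
-- `all?` at that scale exhausts memory.
allBelow : ℕ → (ℕ → Bool) → Bool
allBelow n p = all (p ∘ toℕ) (allFin n)

allBelow-sound : ∀ {n} p → allBelow n p ≡ true → ∀ {k} → k < n → p k ≡ true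
allBelow-sound p h {k} k<n = subst (λ k → p k ≡ true) (toℕ-fromℕ< k<n) (all-allFin (p ∘ toℕ) h (Fin.fromℕ< k<n))

allVecsBelow : ∀ k → ℕ → (Vec ℕ k → Bool) → Bool
allVecsBelow zero    n p = p []
allVecsBelow (suc k) n p = allBelow n λ a → allVecsBelow k n (p ∘ (a ∷_))

allVecsBelow-sound : ∀ {k n} p → allVecsBelow k n p ≡ true → ∀ xs → (∀ i → lookup xs i < n) → p xs ≡ true
allVecsBelow-sound p h []       _    = h
allVecsBelow-sound p h (x ∷ xs) xs<n =
  allVecsBelow-sound (p ∘ (x ∷_)) (allBelow-sound (λ a → allVecsBelow _ _ (p ∘ (a ∷_))) h (xs<n zero)) xs (xs<n ∘ suc)

if-sound : ∀ {A : Set} (a? : Dec A) {b} → (if isYes a? then b else true) ≡ true → A → b ≡ true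
if-sound (yes _) h _ = h
if-sound (no ¬a) _ a = contradiction a ¬a

maybe-sound : ∀ {A : Set} {P : A → Set} (p : A → Bool) → (∀ x → p x ≡ true → P x) →
              ∀ mx → maybe p false mx ≡ true → ∃ P
maybe-sound p sound (just x) h = x , sound x h

T-∧⁻ : ∀ {x y} → T (x ∧ y) → T x × T y
T-∧⁻ = Equivalence.to T-∧

-- Searching and certifying splits

Solution : Table ℕ → Fin 7 → Fin 7 → Fin 7 → Table ℕ → Set
Solution m b₁ b₂ b₃ f = f ≤ᵗ m × ∂ (flow f m) v1 ≡₇ b₁ × ∂ (flow f m) v2 ≡₇ b₂ × ∂ (flow f m) v3 ≡₇ b₃

Solvable : Table ℕ → Set
Solvable m = ∀ b₁ b₂ b₃ → ∃ (Solution m b₁ b₂ b₃)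

isSolution : Table ℕ → Fin 7 → Fin 7 → Fin 7 → Table ℕ → Bool
isSolution m b₁ b₂ b₃ f = all (λ p → f p ≤ᵇ m p) (allFin 6)
  ∧ isYes (∂ (flow f m) v1 ≡₇? b₁) ∧ isYes (∂ (flow f m) v2 ≡₇? b₂) ∧ isYes (∂ (flow f m) v3 ≡₇? b₃)

isSolution-sound : ∀ m b₁ b₂ b₃ f → isSolution m b₁ b₂ b₃ f ≡ true → Solution m b₁ b₂ b₃ f
isSolution-sound m b₁ b₂ b₃ f h =
  let f≤ , h′ = T-∧⁻ {all (λ p → f p ≤ᵇ m p) (allFin 6)} (T-true h)
      c₁ , h″ = T-∧⁻ {isYes (∂ t v1 ≡₇? b₁)} h′
      c₂ , c₃ = T-∧⁻ {isYes (∂ t v2 ≡₇? b₂)} h″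
  in  (λ p → ≤ᵇ⇒≤ (f p) (m p) (All.lookup (all⁺ (λ p → f p ≤ᵇ m p) (allFin 6) f≤) (∈-allFin p)))
    , toWitness {a? = ∂ t v1 ≡₇? b₁} c₁ , toWitness {a? = ∂ t v2 ≡₇? b₂} c₂ , toWitness {a? = ∂ t v3 ≡₇? b₃} c₃
  where t = flow f m

table : ℕ → ℕ → ℕ → ℕ → ℕ → ℕ → Table ℕ
table a _ _ _ _ _ ₁₂ = a
table _ b _ _ _ _ ₁₃ = b
table _ _ c _ _ _ ₁₄ = c
table _ _ _ d _ _ ₂₃ = d
table _ _ _ _ e _ ₂₄ = e
table _ _ _ _ _ f ₃₄ = f

table-η : ∀ m → table (m ₁₂) (m ₁₃) (m ₁₄) (m ₂₃) (m ₂₄) (m ₃₄) ≗ m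
table-η m ₁₂ = refl
table-η m ₁₃ = refl
table-η m ₁₄ = refl
table-η m ₂₃ = refl
table-η m ₂₄ = refl
table-η m ₃₄ = refl

firstUpTo : ∀ {A : Set} → ℕ → (ℕ → Maybe A) → Maybe A
firstUpTo zero    g = g zero
firstUpTo (suc n) g = g (suc n) <∣> firstUpTo n g

-- Given the split on the triangle 123, the congruences at 1, 2 and 3 determine the split on
-- the star at 4 modulo 7; only the bounds remain to be checked.
candidate : Table ℕ → Fin 7 → Fin 7 → Fin 7 → Maybe (Table ℕ)
candidate m b₁ b₂ b₃ =
  firstUpTo (m ₁₂) λ a → firstUpTo (m ₁₃) λ b →
  halfWithin (m ₁₄) (toℕ b₁ + m ₁₂ + 5 * a + m ₁₃ + 5 * b + m ₁₄) >>= λ f₁₄ →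
  firstUpTo (m ₂₃) λ c →
  halfWithin (m ₂₄) (toℕ b₂ + 2 * a + 6 * m ₁₂ + m ₂₃ + 5 * c + m ₂₄) >>= λ f₂₄ →
  halfWithin (m ₃₄) (toℕ b₃ + 2 * b + 6 * m ₁₃ + 2 * c + 6 * m ₂₃ + m ₃₄) >>= λ f₃₄ →
  just (table a b f₁₄ c f₂₄ f₃₄)
  where
  -- 4 = 2⁻¹ (mod 7), so x solves 2 x ≡ n (mod 7)
  halfWithin : ℕ → ℕ → Maybe ℕ
  halfWithin bound n = if x ≤ᵇ bound then just x else nothing
    where x = 4 * n % 7

certifiedAt : Table ℕ → Fin 7 → Fin 7 → Fin 7 → Bool
certifiedAt m b₁ b₂ b₃ = maybe (isSolution m b₁ b₂ b₃) false (candidate m b₁ b₂ b₃)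

certified : Table ℕ → Bool
certified m = all (λ b₁ → all (λ b₂ → all (certifiedAt m b₁ b₂) (allFin 7)) (allFin 7)) (allFin 7)

certified⇒certifiedAt : ∀ m → certified m ≡ true → ∀ b₁ b₂ b₃ → certifiedAt m b₁ b₂ b₃ ≡ true
certified⇒certifiedAt m h b₁ b₂ b₃ =
  all-allFin (certifiedAt m b₁ b₂) (all-allFin (λ b₂ → all (certifiedAt m b₁ b₂) (allFin 7))
    (all-allFin (λ b₁ → all (λ b₂ → all (certifiedAt m b₁ b₂) (allFin 7)) (allFin 7)) h b₁) b₂) b₃

certified-solvable : ∀ m → certified m ≡ true → Solvable m
certified-solvable m h b₁ b₂ b₃ =
  maybe-sound (isSolution m b₁ b₂ b₃) (isSolution-sound m b₁ b₂ b₃) (candidate m b₁ b₂ b₃)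
              (certified⇒certifiedAt m h b₁ b₂ b₃)

solvable-resp : ∀ {m m′} → m ≗ m′ → Solvable m → Solvable m′
solvable-resp m≗m′ solvable b₁ b₂ b₃ =
  let f , f≤ , c₁ , c₂ , c₃ = solvable b₁ b₂ b₃
      same-∂ = ∂-cong (λ p → cong (surplus (f p)) (m≗m′ p))
  in  f , (λ p → subst (f p ≤_) (m≗m′ p) (f≤ p))
        , subst (_≡₇ b₁) (same-∂ v1) c₁ , subst (_≡₇ b₂) (same-∂ v2) c₂ , subst (_≡₇ b₃) (same-∂ v3) c₃

Admissible : Table ℕ → Set
Admissible m = total m ≡ 19 × (∀ v → 8 ≤ incident m v)

admissible? : ∀ m → Dec (Admissible m)
admissible? m = total m ℕ.≟ 19 ×-dec all? (λ v → 8 ℕ.≤? incident m v)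

certifiedIfAdmissible : Table ℕ → Bool
certifiedIfAdmissible m = if isYes (admissible? m) then certified m else true

certifiedIfAdmissible-sound : ∀ m → certifiedIfAdmissible m ≡ true → Admissible m → Solvable m
certifiedIfAdmissible-sound m h admissible = certified-solvable m (if-sound (admissible? m) h admissible)

certifiedIfAdmissibleᵛ : Vec ℕ 6 → Bool
certifiedIfAdmissibleᵛ (a ∷ b ∷ c ∷ d ∷ e ∷ f ∷ []) = certifiedIfAdmissible (table a b c d e f)

-- Closed checks are stated as `≡ true` rather than `T …`: an expected type `T b` is reduced to
-- weak head normal form, which would rerun the whole computation at every use.
every-profile-certified : allVecsBelow 6 6 certifiedIfAdmissibleᵛ ≡ true
every-profile-certified = refl

stronglyZ7Connected : ∀ G → Solvable (profile G) → StronglyZ7Connected G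
stronglyZ7Connected G solvable β boundary =
  let f , f≤ , c₁ , c₂ , c₃ = solvable (β v1) (β v2) (β v3)
      D , D-net             = realise G f f≤
  in  D , λ v → subst (_≡₇ β v) (sym (D-net v)) (congruent (flow f (profile G)) β boundary c₁ c₂ c₃ v)

admissible : ∀ G → Loopless G → length G ≡ 19 → MinDegAtLeast G 8 → Admissible (profile G)
admissible G loopless size δ≥8 =
  trans (sym (length≡total G loopless)) size , λ v → subst (8 ≤_) (deg≡incident G loopless v) (δ≥8 v)

solvable-if-admissible : ∀ m → (∀ p → m p ≤ 5) → Admissible m → Solvable m
solvable-if-admissible m m≤5 (size , degree) =
  solvable-resp (table-η m) (certifiedIfAdmissible-sound m′ checked (size , degree′))
  where
  m′ : Table ℕ
  m′ = table (m ₁₂) (m ₁₃) (m ₁₄) (m ₂₃) (m ₂₄) (m ₃₄)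
  checked : certifiedIfAdmissible m′ ≡ true
  checked = allVecsBelow-sound {6} {6} certifiedIfAdmissibleᵛ every-profile-certified (tabulate m)
              (λ p → subst (_< 6) (sym (lookup∘tabulate m p)) (s≤s (m≤5 p)))
  degree′ : ∀ v → 8 ≤ incident m′ v
  degree′ zero                   = degree v1
  degree′ (suc zero)             = degree v2
  degree′ (suc (suc zero))       = degree v3
  degree′ (suc (suc (suc zero))) = degree v4

fiveC4=-certified : certified (table 4 0 5 5 0 4) ≡ true
fiveC4=-certified = refl

fiveC4=-solvable : Solvable (profile fiveC4=)
fiveC4=-solvable = solvable-resp profile-fiveC4= (certified-solvable _ fiveC4=-certified)
  where
  profile-fiveC4= : table 4 0 5 5 0 4 ≗ profile fiveC4=
  profile-fiveC4= ₁₂ = refl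
  profile-fiveC4= ₁₃ = refl
  profile-fiveC4= ₁₄ = refl
  profile-fiveC4= ₂₃ = refl
  profile-fiveC4= ₂₄ = refl
  profile-fiveC4= ₃₄ = refl

lemma3p7 : StronglyZ7Connected fiveC4=
  × ((G : Multigraph 4) → Loopless G → length G ≡ 19
     → MaxMultAtMost G 5 → MinDegAtLeast G 8 → StronglyZ7Connected G)
lemma3p7 = stronglyZ7Connected fiveC4= fiveC4=-solvable
         , λ G loopless size μ≤5 δ≥8 → stronglyZ7Connected G
             (solvable-if-admissible (profile G) (λ p → μ≤5 (low p) (high p) (low≢high p)) (admissible G loopless size δ≥8))
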